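{- Let $\sigma$ be a permutation of $[k]$. Then $\sigma$ is weakly consecutive if and only if $S_m^\sigma = T_m^\sigma$ for all $m\in[k]$.
   Context: $[k]=\{1,\dots,k\}$. A permutation $\sigma:[k]\to[k]$ is weakly consecutive if for all $i,j\in[k]$ and all integers $m$, whenever $m\mid\sigma(i)$ and $m\mid(i-j)$, also $m\mid\sigma(j)$. For a permutation $\sigma$ of $[k]$ and $m\in[k]$, define $S_m^\sigma=\{i\in[k]: i\equiv\sigma^{ -1}(m)\pmod m\}$ and $T_m^\sigma=\{i\in[k]: m\mid\sigma(i)\}$. -}

module Defs where

open import Data.Nat using (ℕ; suc)
open import Data.Fin using (Fin; toℕ)
open import Data.Integer using (ℤ; +_; _-_)
open import Data.Integer.Divisibility using (_∣_)
open import Function.Bundles using (_↔_; Inverse; _⇔_)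

-- Elements of [k] = {1,…,k} are represented by Fin k, with  x : Fin k
-- standing for the number  toℕ x + 1.
val : ∀ {k} → Fin k → ℤ
val x = + suc (toℕ x)

Perm : ℕ → Set
Perm k = Fin k ↔ Fin k

app : ∀ {k} → Perm k → Fin k → Fin k
app σ = Inverse.to σ

σval : ∀ {k} → Perm k → Fin k → ℤ
σval σ i = val (app σ i)

WeaklyConsecutive : ∀ {k} → Perm k → Set
WeaklyConsecutive {k} σ =
  (i j : Fin k) (m : ℤ) → m ∣ σval σ i → m ∣ (val i - val j) → m ∣ σval σ j

_≡_[mod_] : ℤ → ℤ → ℤ → Set
a ≡ b [mod m ] = m ∣ (a - b)

InS : ∀ {k} → Perm k → (mi : Fin k) → Fin k → Set
InS σ mi i = val i ≡ val (Inverse.from σ mi) [mod val mi ]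

InT : ∀ {k} → Perm k → (mi : Fin k) → Fin k → Set
InT σ mi i = val mi ∣ σval σ i

SeqT : ∀ {k} → Perm k → Fin k → Set
SeqT {k} σ mi = (i : Fin k) → InS σ mi i ⇔ InT σ mi i

-- (⇐) If m divides σ(i) and i ≡ j (mod m), then m ≤ σ(i) ≤ k, so i ∈ T_m = S_m,
-- hence j ∈ S_m = T_m.  (⇒) With j = σ⁻¹(m), weak consecutivity applied to j gives
-- S_m ⊆ T_m.  Conversely, the residue class of j in [k] has at least ⌊k/m⌋ elements,
-- all in T_m; an extra element of T_m ∖ S_m would give ⌊k/m⌋ + 1 elements that σ maps
-- injectively into the ⌊k/m⌋ multiples of m in [k].
module Submission where

open import Defs
open import Data.Nat using (ℕ; suc; zero; _+_; _*_; _≤_; _<_; _∸_; NonZero)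
open import Data.Nat.Properties
open import Data.Nat.DivMod
import Data.Nat.Divisibility as ℕ
import Data.Integer as ℤ
open ℤ using (ℤ; +_)
open import Data.Integer.Properties using (pos-*)
import Data.Integer.Divisibility.Signed as ℤˢ
open import Data.Integer.Tactic.RingSolver using (solve-∀)
open import Data.Fin using (Fin; toℕ; fromℕ<) renaming (zero to fzero; suc to fsuc)
open import Data.Fin.Properties using (toℕ<n; toℕ-fromℕ<; toℕ-injective; <⇒notInjective)
open import Data.Vec.Functional using (_∷_)
open import Data.Product using (Σ; _,_)
open import Function.Base using (_∘_)
open import Function.Bundles using (_⇔_; Inverse; Injection; mk⇔; Equivalence)
open import Function.Properties.Inverse using (↔⇒↣)
open import Function.Definitions using (Injective)
open import Relation.Binary.PropositionalEquality
open import Relation.Nullary using (yes; no; contradiction)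

≡[mod]-sym : ∀ {a b m} → a ≡ b [mod m ] → b ≡ a [mod m ]
≡[mod]-sym {a} {b} {m} m∣a-b =
  ℤˢ.∣⇒∣ᵤ (subst (m ℤˢ.∣_) (neg-diff a b) (ℤˢ.∣m⇒∣-m (ℤˢ.∣ᵤ⇒∣ {m} {a ℤ.- b} m∣a-b)))
  where
  neg-diff : ∀ (a b : ℤ) → ℤ.- (a ℤ.- b) ≡ b ℤ.- a
  neg-diff = solve-∀

≡[mod]-trans : ∀ {a b c m} → a ≡ b [mod m ] → b ≡ c [mod m ] → a ≡ c [mod m ]
≡[mod]-trans {a} {b} {c} {m} m∣a-b m∣b-c =
  ℤˢ.∣⇒∣ᵤ (subst (m ℤˢ.∣_) (telescope a b c)
    (ℤˢ.∣m∣n⇒∣m+n (ℤˢ.∣ᵤ⇒∣ {m} {a ℤ.- b} m∣a-b) (ℤˢ.∣ᵤ⇒∣ {m} {b ℤ.- c} m∣b-c)))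
  where
  telescope : ∀ (a b c : ℤ) → (a ℤ.- b) ℤ.+ (b ℤ.- c) ≡ a ℤ.- c
  telescope = solve-∀

shift-≡[mod] : ∀ (r a b M : ℕ) → (+ suc (r + a * M)) ≡ (+ suc (r + b * M)) [mod (+ M) ]
shift-≡[mod] r a b M =
  ℤˢ.∣⇒∣ᵤ (subst (+ M ℤˢ.∣_) (sym difference) (ℤˢ.∣n⇒∣m*n (+ a ℤ.- + b) ℤˢ.∣-refl))
  where
  as-ℤ : ∀ c → + suc (r + c * M) ≡ + 1 ℤ.+ (+ r ℤ.+ + c ℤ.* + M)
  as-ℤ c = cong (λ z → + 1 ℤ.+ (+ r ℤ.+ z)) (pos-* c M)
  cancel : ∀ (x y z w : ℤ) → (+ 1 ℤ.+ (x ℤ.+ y ℤ.* w)) ℤ.- (+ 1 ℤ.+ (x ℤ.+ z ℤ.* w))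
                            ≡ (y ℤ.- z) ℤ.* w
  cancel = solve-∀
  difference : + suc (r + a * M) ℤ.- + suc (r + b * M) ≡ (+ a ℤ.- + b) ℤ.* + M
  difference = trans (cong₂ ℤ._-_ (as-ℤ a) (as-ℤ b)) (cancel (+ r) (+ a) (+ b) (+ M))

divisor-in-range : ∀ {k n} (x : Fin k) → n ℕ.∣ suc (toℕ x) → Σ (Fin k) λ d → suc (toℕ d) ≡ n
divisor-in-range {n = zero} x 0∣ = contradiction (ℕ.0∣⇒≡0 0∣) λ ()
divisor-in-range {k} {suc n} x n∣x = fromℕ< n<k , cong suc (toℕ-fromℕ< n<k)
  where
  n<k : n < k
  n<k = ≤-trans (ℕ.∣⇒≤ n∣x) (toℕ<n x)

module _ {k M : ℕ} .{{_ : NonZero M}} where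

  quotient<k/M : (x : Fin k) → M ℕ.∣ suc (toℕ x) → toℕ x / M < k / M
  quotient<k/M x M∣x = m<n*o⇒m/o<n (begin-strict
    toℕ x                 <⟨ n<1+n (toℕ x) ⟩
    suc (toℕ x)           ≡⟨ m/n*n≡m M∣x ⟨
    suc (toℕ x) / M * M   ≤⟨ *-monoˡ-≤ M (/-monoˡ-≤ M (toℕ<n x)) ⟩
    k / M * M             ∎)
    where open ≤-Reasoning

  quotient-injective : ∀ {a b} → M ℕ.∣ suc a → M ℕ.∣ suc b → a / M ≡ b / M → a ≡ b
  quotient-injective {a} {b} M∣a M∣b a/M≡b/M = begin
    a                  ≡⟨ m≡m%n+[m/n]*n a M ⟩
    a % M + a / M * M  ≡⟨ cong₂ (λ u v → u + v * M) a%M≡b%M a/M≡b/M ⟩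
    b % M + b / M * M  ≡⟨ m≡m%n+[m/n]*n b M ⟨
    b                  ∎
    where
    open ≡-Reasoning
    remainder : ∀ {c} → M ℕ.∣ suc c → c % M ≡ M ∸ 1
    remainder {c} M∣c = %-pred-≡0 (ℕ.n∣m⇒m%n≡0 (suc c) M M∣c)
    a%M≡b%M : a % M ≡ b % M
    a%M≡b%M = trans (remainder M∣a) (sym (remainder M∣b))

  injective-into-multiples⇒≤ : ∀ {n} (f : Fin n → Fin k) → Injective _≡_ _≡_ f →
                               (∀ u → M ℕ.∣ suc (toℕ (f u))) → n ≤ k / M
  injective-into-multiples⇒≤ {n} f f-inj M∣f = ≮⇒≥ (λ k/M<n → <⇒notInjective k/M<n index-injective)
    where
    index : Fin n → Fin (k / M)
    index u = fromℕ< (quotient<k/M (f u) (M∣f u))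
    index-injective : Injective _≡_ _≡_ index
    index-injective {u} {v} eq = f-inj (toℕ-injective (quotient-injective (M∣f u) (M∣f v)
      (trans (sym (toℕ-fromℕ< _)) (trans (cong toℕ eq) (toℕ-fromℕ< _)))))

  residue<k : ∀ {r} → r < M → (t : Fin (k / M)) → r + toℕ t * M < k
  residue<k {r} r<M t = begin-strict
    r + toℕ t * M   <⟨ +-monoˡ-< (toℕ t * M) r<M ⟩
    suc (toℕ t) * M ≤⟨ *-monoˡ-≤ M (toℕ<n t) ⟩
    k / M * M       ≤⟨ m/n*n≤m k M ⟩
    k               ∎
    where open ≤-Reasoning

  residueClass : ∀ {r} → r < M → Fin (k / M) → Fin k
  residueClass r<M t = fromℕ< (residue<k r<M t)

  toℕ-residueClass : ∀ {r} (r<M : r < M) t → toℕ (residueClass r<M t) ≡ r + toℕ t * M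
  toℕ-residueClass r<M t = toℕ-fromℕ< (residue<k r<M t)

  residueClass-injective : ∀ {r} (r<M : r < M) → Injective _≡_ _≡_ (residueClass r<M)
  residueClass-injective {r} r<M {t} {u} eq = toℕ-injective (*-cancelʳ-≡ (toℕ t) (toℕ u) M
    (+-cancelˡ-≡ r _ _ (trans (sym (toℕ-residueClass r<M t))
                       (trans (cong toℕ eq) (toℕ-residueClass r<M u)))))

∷-injective : ∀ {A : Set} {n} {a : A} {f : Fin n → A} →
              (∀ t → f t ≢ a) → Injective _≡_ _≡_ f → Injective _≡_ _≡_ (a ∷ f)
∷-injective f≢a f-inj {fzero}  {fzero}  eq = refl
∷-injective f≢a f-inj {fzero}  {fsuc u} eq = contradiction (sym eq) (f≢a u)
∷-injective f≢a f-inj {fsuc t} {fzero}  eq = contradiction eq (f≢a t)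
∷-injective f≢a f-inj {fsuc t} {fsuc u} eq = cong fsuc (f-inj eq)

module _ {k : ℕ} (σ : Perm k) where

  S≡T⇒weaklyConsecutive : ((m : Fin k) → SeqT σ m) → WeaklyConsecutive σ
  S≡T⇒weaklyConsecutive S≡T i j m = closed ℤ.∣ m ∣
    where
    closed : ∀ n → n ℕ.∣ suc (toℕ (app σ i)) → n ℕ.∣ ℤ.∣ val i ℤ.- val j ∣ →
             n ℕ.∣ suc (toℕ (app σ j))
    closed n n∣σi n∣i-j with divisor-in-range (app σ i) n∣σi
    ... | d , refl = Equivalence.to (S≡T d j)
      (≡[mod]-trans {val j} {val i} {val (Inverse.from σ d)} {val d}
        (≡[mod]-sym {val i} {val j} {val d} n∣i-j) (Equivalence.from (S≡T d i) n∣σi))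

  module _ (wc : WeaklyConsecutive σ) (m : Fin k) where

    private
      M : ℕ
      M = suc (toℕ m)

      j : Fin k
      j = Inverse.from σ m

      j%M<M : toℕ j % M < M
      j%M<M = m%n<n (toℕ j) M

      m∣σj : InT σ m j
      m∣σj = subst (λ x → M ℕ.∣ suc (toℕ x)) (sym (Inverse.strictlyInverseˡ σ m)) ℕ.∣-refl

    S⊆T : ∀ i → InS σ m i → InT σ m i
    S⊆T i i∈S = wc j i (val m) m∣σj (≡[mod]-sym {val i} {val j} {val m} i∈S)

    residueClass-j⊆S : ∀ t → InS σ m (residueClass j%M<M t)
    residueClass-j⊆S t =
      subst₂ (λ x y → (+ suc x) ≡ (+ suc y) [mod (+ M) ])
        (sym (toℕ-residueClass j%M<M t)) (sym (m≡m%n+[m/n]*n (toℕ j) M))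
        (shift-≡[mod] (toℕ j % M) (toℕ t) (toℕ j / M) M)

    T⊆S : ∀ i → InT σ m i → InS σ m i
    T⊆S i i∈T with M ℕ.∣? ℤ.∣ val i ℤ.- val j ∣
    ... | yes i∈S = i∈S
    ... | no  i∉S = contradiction (injective-into-multiples⇒≤ (app σ ∘ X) σ∘X-injective X⊆T) 1+n≰n
      where
      X : Fin (suc (k / M)) → Fin k
      X = i ∷ residueClass j%M<M
      σ∘X-injective : Injective _≡_ _≡_ (app σ ∘ X)
      σ∘X-injective = ∷-injective (λ t eq → i∉S (subst (InS σ m) eq (residueClass-j⊆S t)))
                      (residueClass-injective j%M<M) ∘ Injection.injective (↔⇒↣ σ)
      X⊆T : ∀ u → InT σ m (X u)
      X⊆T fzero    = i∈T
      X⊆T (fsuc t) = S⊆T _ (residueClass-j⊆S t)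

    weaklyConsecutive⇒S≡T : SeqT σ m
    weaklyConsecutive⇒S≡T i = mk⇔ (S⊆T i) (T⊆S i)

mainTheorem4 : (k : ℕ) (σ : Perm k) →
    WeaklyConsecutive σ ⇔ ((m : Fin k) → SeqT σ m)
mainTheorem4 k σ = mk⇔ (weaklyConsecutive⇒S≡T σ) (S≡T⇒weaklyConsecutive σ)
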